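{- Let $G_1$ be a graph cellularly embedded in a closed surface, with edge set $E$, let $G_2$ be its surface dual and $G_3$ its phial, and suppose the map $G_3$ is rich. Then the maximum cardinality of a coboundary in $G_3$ equals $|E|$ minus the minimum cardinality of a strong $O$-join in $G_1$.
   Context: $2^E$ is the $GF(2)$-vector space of subsets of $E$ under symmetric difference; $A,B$ are orthogonal if $|A\cap B|$ is even, and $W^\perp$ is the set of subsets orthogonal to every element of $W$. A zigzag path (Petrie walk) of $G_1$ is a closed walk which at successive vertices alternately leaves along the edge immediately left and immediately right (in the local rotation) of the arriving edge; each edge is traversed exactly twice in total by the zigzag paths. $G_2$ is the graph with edge set $E$ whose vertices are the faces of $G_1$ (edge $e$ joins the faces on its two sides), and the phial $G_3$ is the graph with edge set $E$ whose vertices are the zigzag paths of $G_1$ (edge $e$ joins the zigzags traversing it). For $i=1,2,3$, $\mathcal{V}_i$ is the subspace of $2^E$ spanned by the vertex coboundaries of $G_i$ (the coboundary of a vertex is the set of non-loop edges incident to it). For a permutation $(i,j,k)$ of $(1,2,3)$, the cycle deficiency is $\mathrm{cdef}(G_i)=\dim(\mathcal{V}_i^\perp/(\mathcal{V}_j+\mathcal{V}_k))$, and $G_i$ is rich if $\mathrm{cdef}(G_i)=0$. A coboundary of a graph is a set of the form $\delta(W)$, the set of edges with exactly one end in the vertex subset $W$. A strong $O$-join of $G_1$ is a set $F\subseteq E$ such that for every vertex $v$ of $G_1$, the number of edges of $F$ in the coboundary of $v$ has the same parity as the degree of $v$, and for every face $f$ of $G_1$, the number of edges of $F$ in the boundary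 of $f$ has the same parity as the degree (length) of $f$. -}

module Defs where

open import Data.Nat using (ℕ; zero; suc; _+_; _%_)
open import Data.Bool using (Bool; true; false; if_then_else_; _xor_)
open import Data.Fin using (Fin; zero; suc; _≟_)
open import Data.Fin.Subset using (Subset; ⊥; ⁅_⁆; _∩_; ∣_∣)
open import Data.Vec using (Vec; []; _∷_; tabulate; lookup; zipWith)
open import Data.List using (List; []; _∷_; map; allFin)
open import Data.Nat.ListAction using (sum)
open import Data.List.Membership.Propositional using (_∈_)
open import Data.Product using (_×_; ∃; ∃₂)
open import Function using (_∘_; _⇔_)
open import Relation.Binary.PropositionalEquality using (_≡_; _≢_)
open import Relation.Nullary.Decidable using (⌊_⌋)

-- GF(2)-vector space 2^E with E = Fin m (subsets as Subset m)

_⊕_ : ∀ {m} → Subset m → Subset m → Subset m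
_⊕_ = zipWith _xor_

Orth : ∀ {m} → Subset m → Subset m → Set
Orth A B = ∣ A ∩ B ∣ % 2 ≡ 0

sumSel : ∀ {k m} → (Fin k → Subset m) → Subset k → Subset m
sumSel g [] = ⊥
sumSel g (b ∷ W) = (if b then g zero else ⊥) ⊕ sumSel (g ∘ suc) W

Span : ∀ {k m} → (Fin k → Subset m) → Subset m → Set
Span g X = ∃ λ W → X ≡ sumSel g W

InSum : ∀ {k l m} → (Fin k → Subset m) → (Fin l → Subset m) → Subset m → Set
InSum g h X = ∃₂ λ A B → Span g A × Span h B × X ≡ A ⊕ B

InPerp : ∀ {k m} → (Fin k → Subset m) → Subset m → Set
InPerp g X = ∀ Y → Span g Y → Orth X Y

-- Abstract graphs with edge set Fin m and vertex set Fin k, given by the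
-- two ends of each edge.

δ : ∀ {k m} → (Fin m → Fin k) → (Fin m → Fin k) → Subset k → Subset m
δ e₁ e₂ W = tabulate λ e → lookup W (e₁ e) xor lookup W (e₂ e)

-- vertex coboundary: the non-loop edges incident to v
vcob : ∀ {k m} → (Fin m → Fin k) → (Fin m → Fin k) → Fin k → Subset m
vcob e₁ e₂ v = δ e₁ e₂ ⁅ v ⁆

-- degree (loops counted twice)
deg : ∀ {k m} → (Fin m → Fin k) → (Fin m → Fin k) → Fin k → ℕ
deg {m = m} e₁ e₂ v =
  sum (map (λ e → (if ⌊ e₁ e ≟ v ⌋ then 1 else 0) + (if ⌊ e₂ e ≟ v ⌋ then 1 else 0)) (allFin m))

-- Maps (graphs cellularly embedded in closed surfaces), encoded by flags:
-- three fixed-point-free involutions τ₀ τ₁ τ₂ on a finite set of flags,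
-- τ₀τ₂ = τ₂τ₀ fixed-point-free, generating a transitive group.
-- Edges = ⟨τ₀,τ₂⟩-orbits, vertices = ⟨τ₁,τ₂⟩-orbits, faces = ⟨τ₀,τ₁⟩-orbits,
-- zigzags (Petrie walks) = ⟨τ₁,τ₀τ₂⟩-orbits.

data Reach {n : ℕ} (gens : List (Fin n → Fin n)) : Fin n → Fin n → Set where
  here : ∀ {f} → Reach gens f f
  step : ∀ {s f g} → s ∈ gens → Reach gens (s f) g → Reach gens f g

record Orbits {n : ℕ} (gens : List (Fin n → Fin n)) (k : ℕ) : Set where
  field
    orbitOf  : Fin n → Fin k
    rep      : Fin k → Fin n
    orbitRep : ∀ i → orbitOf (rep i) ≡ i
    orbitEq  : ∀ f g → (orbitOf f ≡ orbitOf g) ⇔ Reach gens f g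

record Map : Set where
  field
    nflags : ℕ
    aFlag  : Fin nflags
    τ₀ τ₁ τ₂ : Fin nflags → Fin nflags
    inv₀ : ∀ f → τ₀ (τ₀ f) ≡ f
    inv₁ : ∀ f → τ₁ (τ₁ f) ≡ f
    inv₂ : ∀ f → τ₂ (τ₂ f) ≡ f
    fpf₀ : ∀ f → τ₀ f ≢ f
    fpf₁ : ∀ f → τ₁ f ≢ f
    fpf₂ : ∀ f → τ₂ f ≢ f
    comm₀₂ : ∀ f → τ₀ (τ₂ f) ≡ τ₂ (τ₀ f)
    fpf₀₂  : ∀ f → τ₀ (τ₂ f) ≢ f
    connected : ∀ f g → Reach (τ₀ ∷ τ₁ ∷ τ₂ ∷ []) f g
    nE nV nF nZ : ℕ
    edges    : Orbits (τ₀ ∷ τ₂ ∷ []) nE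
    vertices : Orbits (τ₁ ∷ τ₂ ∷ []) nV
    faces    : Orbits (τ₀ ∷ τ₁ ∷ []) nF
    zigzags  : Orbits (τ₁ ∷ (τ₀ ∘ τ₂) ∷ []) nZ

  open Orbits

  private
    fl : Fin nE → Fin nflags
    fl = rep edges

  end₁ end₁' : Fin nE → Fin nV
  end₁  e = orbitOf vertices (fl e)
  end₁' e = orbitOf vertices (τ₀ (fl e))

  -- G₂ (surface dual): the faces on the two sides, of f and τ₂ f
  end₂ end₂' : Fin nE → Fin nF
  end₂  e = orbitOf faces (fl e)
  end₂' e = orbitOf faces (τ₂ (fl e))

  -- G₃ (phial): the two zigzags traversing e, through f and τ₀ f
  end₃ end₃' : Fin nE → Fin nZ
  end₃  e = orbitOf zigzags (fl e)
  end₃' e = orbitOf zigzags (τ₀ (fl e))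

  -- vertex coboundaries generating 𝒱₁, 𝒱₂, 𝒱₃
  cob₁ : Fin nV → Subset nE
  cob₁ = vcob end₁ end₁'
  cob₂ : Fin nF → Subset nE
  cob₂ = vcob end₂ end₂'
  cob₃ : Fin nZ → Subset nE
  cob₃ = vcob end₃ end₃'

  δ₃ : Subset nZ → Subset nE
  δ₃ = δ end₃ end₃'

  -- G₃ rich: cdef(G₃) = dim(𝒱₃^⊥ / (𝒱₁ + 𝒱₂)) = 0, i.e. 𝒱₃^⊥ ⊆ 𝒱₁ + 𝒱₂
  Rich₃ : Set
  Rich₃ = ∀ X → InPerp cob₃ X → InSum cob₁ cob₂ X

  StrongOJoin : Subset nE → Set
  StrongOJoin F =
    (∀ v → ∣ F ∩ cob₁ v ∣ % 2 ≡ deg end₁ end₁' v % 2) ×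
    (∀ f → ∣ F ∩ cob₂ f ∣ % 2 ≡ deg end₂ end₂' f % 2)

-- Every vertex coboundary of G₁ or of G₂ is orthogonal to every vertex coboundary of the phial G₃.
-- Indeed, at an edge the product of the two coboundary entries is the sum, over the four flags of the
-- edge, of a function of flags invariant under τ₁; summing over all edges gives its sum over all flags,
-- which vanishes because the fixed-point-free involution τ₁ pairs the flags up.  The parity conditions
-- defining a strong O-join F say exactly that the complement of F is orthogonal to 𝒱₁ and 𝒱₂, so the
-- complement of every coboundary of G₃ is a strong O-join.  Conversely, if G₃ is rich then
-- 𝒱₃^⊥ ⊆ 𝒱₁ + 𝒱₂, so the complement of a strong O-join lies in 𝒱₃^⊥⊥ = 𝒱₃, i.e. it is a coboundary
-- of G₃.  Complementation thus exchanges maximum coboundaries of G₃ and minimum strong O-joins.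
module Submission where

open import Algebra.Bundles using (CommutativeRing)
open import Data.Bool using (Bool; true; false; not; _∧_; _xor_; if_then_else_)
import Data.Bool as Bool
open import Data.Bool.Properties
  using (xor-∧-commutativeRing; xor-assoc; xor-comm; xor-same; xor-identityʳ; ∧-comm; ∧-zeroʳ;
         ∧-identityʳ; ∧-distribˡ-xor; ∧-distribʳ-xor; not-involutive; not-distribˡ-xor; ¬-not)
open import Data.Empty using (⊥-elim)
open import Data.Fin using (Fin; zero; suc; _≟_; _<_)
open import Data.Fin.Permutation using (permutation)
open import Data.Fin.Properties using (_<?_; <-cmp; any?)
open import Data.Fin.Subset using (Subset; ⊥; ⁅_⁆; _∩_; ∣_∣; ∁)
open import Data.Fin.Subset.Properties using (∣∁p∣≡n∸∣p∣; ∣p∣≤n)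
open import Data.List using (List; _∷_; [])
import Data.List as List
open import Data.List.Membership.Propositional using (_∈_)
open import Data.List.Properties using (map-tabulate)
import Data.List.Relation.Unary.Any as Any
open import Data.Nat using (ℕ; zero; suc; _+_; _%_; _≤_; _∸_)
open import Data.Nat.ListAction using () renaming (sum to sumℕ)
open import Data.Nat.Properties
  using (≤-refl; ≤-trans; ≤-total; ∸-monoʳ-≤; m∸[m∸n]≡n; module ≤-Reasoning)
open import Data.Product using (_×_; _,_; ∃; ∃₂; proj₁; proj₂)
open import Data.Sum using (_⊎_; inj₁; inj₂)
open import Data.Vec using ([]; _∷_; lookup)
open import Data.Vec.Properties
  using (lookup-zipWith; lookup-replicate; lookup-map; lookup∘tabulate; tabulate∘lookup;
         tabulate-cong; zipWith-assoc; zipWith-identityˡ)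
open import Function using (_∘_; id; _⇔_; mk⇔; Equivalence)
open import Relation.Binary.Definitions using (tri<; tri≈; tri>)
open import Relation.Binary.PropositionalEquality
  using (_≡_; _≢_; refl; sym; trans; cong; cong₂; subst; module ≡-Reasoning)
open import Relation.Nullary using (does; yes; no)
open import Relation.Nullary.Decidable using (⌊_⌋; isYes≗does; dec-true; dec-false)

open import Algebra.Properties.Semiring.Sum (CommutativeRing.semiring xor-∧-commutativeRing)
  using (sum; sum-cong-≗; sum-replicate-zero; ∑-distrib-+; ∑-comm; sum-permute)
open import Algebra.Properties.CommutativeSemigroup
  (CommutativeRing.+-commutativeSemigroup xor-∧-commutativeRing)
  using () renaming (interchange to xor-interchange)

open import Defs

∑-select : ∀ {n} (a : Fin n) (h : Fin n → Bool) → sum (λ i → does (i ≟ a) ∧ h i) ≡ h a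
∑-select {suc n} zero    h = trans (cong (h zero xor_) (sum-replicate-zero n)) (xor-identityʳ (h zero))
∑-select {suc n} (suc a) h = ∑-select a (h ∘ suc)

∑-select₂ : ∀ {n} (a b : Fin n) (h : Fin n → Bool) →
            sum (λ i → (does (i ≟ a) xor does (i ≟ b)) ∧ h i) ≡ h a xor h b
∑-select₂ a b h = begin
  sum (λ i → (does (i ≟ a) xor does (i ≟ b)) ∧ h i)
    ≡⟨ sum-cong-≗ (λ i → ∧-distribʳ-xor (h i) (does (i ≟ a)) (does (i ≟ b))) ⟩
  sum (λ i → (does (i ≟ a) ∧ h i) xor (does (i ≟ b) ∧ h i))
    ≡⟨ ∑-distrib-+ (λ i → does (i ≟ a) ∧ h i) (λ i → does (i ≟ b) ∧ h i) ⟩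
  sum (λ i → does (i ≟ a) ∧ h i) xor sum (λ i → does (i ≟ b) ∧ h i)
    ≡⟨ cong₂ _xor_ (∑-select a h) (∑-select b h) ⟩
  h a xor h b ∎
  where open ≡-Reasoning

-- Each pair {g, σ g} contributes h g twice; k keeps only the member that is smaller than its image.
∑-invariant-fpf-involution : ∀ {n} (σ : Fin n → Fin n) → (∀ g → σ (σ g) ≡ g) → (∀ g → σ g ≢ g) →
                             (h : Fin n → Bool) → (∀ g → h (σ g) ≡ h g) → sum h ≡ false
∑-invariant-fpf-involution {n} σ σσ≡id σ-fpf h hσ≡h = begin
  sum h                         ≡⟨ sum-cong-≗ split ⟩
  sum (λ g → k g xor k (σ g))   ≡⟨ ∑-distrib-+ k (k ∘ σ) ⟩
  sum k xor sum (k ∘ σ)         ≡⟨ cong (sum k xor_) (sum-permute k (permutation σ σ σσ≡id σσ≡id)) ⟨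
  sum k xor sum k               ≡⟨ xor-same (sum k) ⟩
  false                         ∎
  where
  open ≡-Reasoning
  below : Fin n → Bool
  below g = does (g <? σ g)
  k : Fin n → Bool
  k g = h g ∧ below g
  σσg≡g : ∀ {g} → σ (σ g) ≡ g
  σσg≡g {g} = σσ≡id g
  below-xor : ∀ g → below g xor below (σ g) ≡ true
  below-xor g with <-cmp g (σ g)
  ... | tri< g<σg _ σg≮g =
    cong₂ _xor_ (dec-true (g <? σ g) g<σg) (dec-false (σ g <? σ (σ g)) (σg≮g ∘ subst (σ g <_) σσg≡g))
  ... | tri≈ _ g≡σg _ = ⊥-elim (σ-fpf g (sym g≡σg))
  ... | tri> g≮σg _ σg<g =
    cong₂ _xor_ (dec-false (g <? σ g) g≮σg) (dec-true (σ g <? σ (σ g)) (subst (σ g <_) (sym σσg≡g) σg<g))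
  split : ∀ g → h g ≡ k g xor k (σ g)
  split g = begin
    h g                                  ≡⟨ ∧-identityʳ (h g) ⟨
    h g ∧ true                           ≡⟨ cong (h g ∧_) (below-xor g) ⟨
    h g ∧ (below g xor below (σ g))      ≡⟨ ∧-distribˡ-xor (h g) (below g) (below (σ g)) ⟩
    k g xor (h g ∧ below (σ g))          ≡⟨ cong (λ b → k g xor (b ∧ below (σ g))) (hσ≡h g) ⟨
    k g xor k (σ g)                      ∎

xor-∧-expand : ∀ a a′ b b′ →
               (a xor a′) ∧ (b xor b′) ≡ ((a ∧ b) xor (a′ ∧ b)) xor ((a ∧ b′) xor (a′ ∧ b′))
xor-∧-expand a a′ b b′ =
  trans (∧-distribˡ-xor (a xor a′) b b′) (cong₂ _xor_ (∧-distribʳ-xor b a a′) (∧-distribʳ-xor b′ a a′))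

odd : ℕ → Bool
odd zero    = false
odd (suc n) = not (odd n)

odd-+ : ∀ m n → odd (m + n) ≡ odd m xor odd n
odd-+ zero    n = refl
odd-+ (suc m) n = trans (cong not (odd-+ m n)) (not-distribˡ-xor (odd m) (odd n))

indicator : Bool → ℕ
indicator b = if b then 1 else 0

odd-indicator : ∀ b → odd (indicator b) ≡ b
odd-indicator true  = refl
odd-indicator false = refl

%2≡indicator-odd : ∀ m → m % 2 ≡ indicator (odd m)
%2≡indicator-odd zero          = refl
%2≡indicator-odd (suc zero)    = refl
%2≡indicator-odd (suc (suc m)) =
  trans (%2≡indicator-odd m) (cong indicator (sym (not-involutive (odd m))))

%2≡⇔odd≡ : ∀ m n → (m % 2 ≡ n % 2) ⇔ (odd m ≡ odd n)
%2≡⇔odd≡ m n = mk⇔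
  (λ eq → indicator-injective (trans (sym (%2≡indicator-odd m)) (trans eq (%2≡indicator-odd n))))
  (λ eq → trans (%2≡indicator-odd m) (trans (cong indicator eq) (sym (%2≡indicator-odd n))))
  where
  indicator-injective : ∀ {a b} → indicator a ≡ indicator b → a ≡ b
  indicator-injective {true}  {true}  _ = refl
  indicator-injective {false} {false} _ = refl

lookup-⊕ : ∀ {m} (A B : Subset m) i → lookup (A ⊕ B) i ≡ lookup A i xor lookup B i
lookup-⊕ A B i = lookup-zipWith _xor_ i A B

lookup-⊥ : ∀ {m} (i : Fin m) → lookup ⊥ i ≡ false
lookup-⊥ i = lookup-replicate i false

lookup-⁅⁆ : ∀ {m} (v i : Fin m) → lookup ⁅ v ⁆ i ≡ does (i ≟ v)
lookup-⁅⁆ zero    zero    = refl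
lookup-⁅⁆ zero    (suc i) = lookup-⊥ i
lookup-⁅⁆ (suc v) zero    = refl
lookup-⁅⁆ (suc v) (suc i) = lookup-⁅⁆ v i

lookup-ext : ∀ {m} {A B : Subset m} → (∀ i → lookup A i ≡ lookup B i) → A ≡ B
lookup-ext {A = A} {B} eq = trans (sym (tabulate∘lookup A)) (trans (tabulate-cong eq) (tabulate∘lookup B))

⊕-identityˡ : ∀ {m} (A : Subset m) → ⊥ ⊕ A ≡ A
⊕-identityˡ = zipWith-identityˡ (λ _ → refl)

⊕-cancelˡ : ∀ {m} (A B : Subset m) → A ⊕ (A ⊕ B) ≡ B
⊕-cancelˡ A B = trans (sym (zipWith-assoc xor-assoc A A B)) (trans (cong (_⊕ B) (⊕-self A)) (⊕-identityˡ B))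
  where
  ⊕-self : ∀ {m} (A : Subset m) → A ⊕ A ≡ ⊥
  ⊕-self []      = refl
  ⊕-self (a ∷ A) = cong₂ _∷_ (xor-same a) (⊕-self A)

-- _⊕_ from Defs has the default fixity 20, which _⊙_ must exceed.
infixl 7 _·_
infixr 21 _⊙_

_·_ : ∀ {m} → Subset m → Subset m → Bool
A · B = sum (λ i → lookup A i ∧ lookup B i)

-- Scalar multiplication written as in sumSel, so that sumSel g (c ∷ W) is c ⊙ g zero ⊕ sumSel (g ∘ suc) W.
_⊙_ : ∀ {m} → Bool → Subset m → Subset m
c ⊙ A = if c then A else ⊥

·-comm : ∀ {m} (A B : Subset m) → A · B ≡ B · A
·-comm A B = sum-cong-≗ (λ i → ∧-comm (lookup A i) (lookup B i))

·-zeroʳ : ∀ {m} (A : Subset m) → A · ⊥ ≡ false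
·-zeroʳ {m} A = trans (sum-cong-≗ λ i → trans (cong (lookup A i ∧_) (lookup-⊥ i)) (∧-zeroʳ (lookup A i)))
                      (sum-replicate-zero m)

·-distribʳ-⊕ : ∀ {m} (A B C : Subset m) → A · (B ⊕ C) ≡ A · B xor A · C
·-distribʳ-⊕ A B C =
  trans (sum-cong-≗ distrib) (∑-distrib-+ (λ i → lookup A i ∧ lookup B i) (λ i → lookup A i ∧ lookup C i))
  where
  distrib : ∀ i → lookup A i ∧ lookup (B ⊕ C) i ≡ (lookup A i ∧ lookup B i) xor (lookup A i ∧ lookup C i)
  distrib i =
    trans (cong (lookup A i ∧_) (lookup-⊕ B C i)) (∧-distribˡ-xor (lookup A i) (lookup B i) (lookup C i))

·-distribˡ-⊕ : ∀ {m} (A B C : Subset m) → (A ⊕ B) · C ≡ A · C xor B · C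
·-distribˡ-⊕ A B C = begin
  (A ⊕ B) · C       ≡⟨ ·-comm (A ⊕ B) C ⟩
  C · (A ⊕ B)       ≡⟨ ·-distribʳ-⊕ C A B ⟩
  C · A xor C · B   ≡⟨ cong₂ _xor_ (·-comm C A) (·-comm C B) ⟩
  A · C xor B · C   ∎
  where open ≡-Reasoning

·-⊙ʳ : ∀ {m} (A : Subset m) c B → A · (c ⊙ B) ≡ c ∧ A · B
·-⊙ʳ A true  B = refl
·-⊙ʳ A false B = ·-zeroʳ A

·-⊙ˡ : ∀ {m} c (A B : Subset m) → (c ⊙ A) · B ≡ c ∧ A · B
·-⊙ˡ c A B = trans (·-comm (c ⊙ A) B) (trans (·-⊙ʳ B c A) (cong (c ∧_) (·-comm B A)))

·-⊙⊕ʳ : ∀ {m} (A : Subset m) c B C → A · (c ⊙ B ⊕ C) ≡ c ∧ A · B xor A · C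
·-⊙⊕ʳ A c B C = trans (·-distribʳ-⊕ A (c ⊙ B) C) (cong (_xor A · C) (·-⊙ʳ A c B))

·-⊙⊕ˡ : ∀ {m} c (A B C : Subset m) → (c ⊙ A ⊕ B) · C ≡ c ∧ A · C xor B · C
·-⊙⊕ˡ c A B C = trans (·-distribˡ-⊕ (c ⊙ A) B C) (cong (_xor B · C) (·-⊙ˡ c A C))

·-⁅⁆ : ∀ {m} (A : Subset m) i → A · ⁅ i ⁆ ≡ lookup A i
·-⁅⁆ A i = trans (sum-cong-≗ λ j → trans (cong (lookup A j ∧_) (lookup-⁅⁆ i j)) (∧-comm (lookup A j) _))
                 (∑-select i (lookup A))

odd∣∣ : ∀ {m} (A : Subset m) → odd ∣ A ∣ ≡ sum (lookup A)
odd∣∣ []          = refl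
odd∣∣ (true  ∷ A) = cong not (odd∣∣ A)
odd∣∣ (false ∷ A) = odd∣∣ A

odd∣∩∣ : ∀ {m} (A B : Subset m) → odd ∣ A ∩ B ∣ ≡ A · B
odd∣∩∣ A B = trans (odd∣∣ (A ∩ B)) (sum-cong-≗ (λ i → lookup-zipWith _∧_ i A B))

Orth⇔·≡false : ∀ {m} (A B : Subset m) → Orth A B ⇔ (A · B ≡ false)
Orth⇔·≡false A B = mk⇔
  (λ o → trans (sym (odd∣∩∣ A B)) (Equivalence.to parity o))
  (λ o → Equivalence.from parity (trans (odd∣∩∣ A B) o))
  where parity = %2≡⇔odd≡ ∣ A ∩ B ∣ 0

∁-· : ∀ {m} (A B : Subset m) → ∁ A · B ≡ A · B xor odd ∣ B ∣
∁-· A B = begin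
  ∁ A · B                                                ≡⟨ sum-cong-≗ complement ⟩
  sum (λ i → (lookup A i ∧ lookup B i) xor lookup B i)
    ≡⟨ ∑-distrib-+ (λ i → lookup A i ∧ lookup B i) (lookup B) ⟩
  A · B xor sum (lookup B)                               ≡⟨ cong (A · B xor_) (odd∣∣ B) ⟨
  A · B xor odd ∣ B ∣                                    ∎
  where
  open ≡-Reasoning
  not-∧ : ∀ a b → not a ∧ b ≡ (a ∧ b) xor b
  not-∧ true  b = sym (xor-same b)
  not-∧ false b = refl
  complement : ∀ i → lookup (∁ A) i ∧ lookup B i ≡ (lookup A i ∧ lookup B i) xor lookup B i
  complement i = trans (cong (_∧ lookup B i) (lookup-map i not A)) (not-∧ (lookup A i) (lookup B i))

∁-·≡odd : ∀ {m} (A B : Subset m) → A · B ≡ false → ∁ A · B ≡ odd ∣ B ∣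
∁-·≡odd A B A·B≡false = trans (∁-· A B) (cong (_xor odd ∣ B ∣) A·B≡false)

∁-·≡false : ∀ {m} (A B : Subset m) → A · B ≡ odd ∣ B ∣ → ∁ A · B ≡ false
∁-·≡false A B A·B≡odd = trans (∁-· A B) (trans (cong (_xor odd ∣ B ∣) A·B≡odd) (xor-same (odd ∣ B ∣)))

·-Span≡false : ∀ {k m} {g : Fin k → Subset m} {Y} X → (∀ i → X · g i ≡ false) → Span g Y → X · Y ≡ false
·-Span≡false {g = g} X X⊥g (W , refl) = ·-sumSel≡false g X⊥g W
  where
  ·-sumSel≡false : ∀ {k} (g : Fin k → Subset _) → (∀ i → X · g i ≡ false) → ∀ W → X · sumSel g W ≡ false
  ·-sumSel≡false g X⊥g []      = ·-zeroʳ X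
  ·-sumSel≡false g X⊥g (c ∷ W) = begin
    X · (c ⊙ g zero ⊕ sumSel (g ∘ suc) W)       ≡⟨ ·-⊙⊕ʳ X c (g zero) (sumSel (g ∘ suc) W) ⟩
    c ∧ X · g zero xor X · sumSel (g ∘ suc) W
      ≡⟨ cong₂ (λ a b → c ∧ a xor b) (X⊥g zero) (·-sumSel≡false (g ∘ suc) (X⊥g ∘ suc) W) ⟩
    c ∧ false xor false                         ≡⟨ xor-identityʳ (c ∧ false) ⟩
    c ∧ false                                   ≡⟨ ∧-zeroʳ c ⟩
    false                                       ∎
    where open ≡-Reasoning

·-InSum≡false : ∀ {k l m} {g : Fin k → Subset m} {h : Fin l → Subset m} {Y} X →
                (∀ i → X · g i ≡ false) → (∀ j → X · h j ≡ false) → InSum g h Y → X · Y ≡ false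
·-InSum≡false X X⊥g X⊥h (A , B , A∈ , B∈ , refl) =
  trans (·-distribʳ-⊕ X A B) (cong₂ _xor_ (·-Span≡false X X⊥g A∈) (·-Span≡false X X⊥h B∈))

Separated : ∀ {k m} → (Fin k → Subset m) → Subset m → Set
Separated g X = ∃ λ Y → (∀ i → Y · g i ≡ false) × X · Y ≡ true

-- If g zero lies in the span of the others it can be dropped;
-- otherwise a vector Z separating it from them is used to eliminate g zero from X and then from the
-- separating vector found for the reduced problem.
Span⊎Separated : ∀ {k m} (g : Fin k → Subset m) X → Span g X ⊎ Separated g X
Span⊎Separated {zero} g X with any? (λ i → lookup X i Bool.≟ true)
... | yes (i , Xᵢ≡true) = inj₂ (⁅ i ⁆ , (λ ()) , trans (·-⁅⁆ X i) Xᵢ≡true)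
... | no  ¬∃Xᵢ≡true     = inj₁ ([] , lookup-ext λ i →
                            trans (¬-not (λ Xᵢ≡true → ¬∃Xᵢ≡true (i , Xᵢ≡true))) (sym (lookup-⊥ i)))
Span⊎Separated {suc k} g X with Span⊎Separated (g ∘ suc) (g zero)
... | inj₁ g₀∈Span = drop (Span⊎Separated (g ∘ suc) X)
  where
  drop : Span (g ∘ suc) X ⊎ Separated (g ∘ suc) X → Span g X ⊎ Separated g X
  drop (inj₁ (W , X≡)) = inj₁ (false ∷ W , trans X≡ (sym (⊕-identityˡ _)))
  drop (inj₂ (Y , Y⊥g , X·Y)) =
    inj₂ (Y , (λ { zero → ·-Span≡false Y Y⊥g g₀∈Span ; (suc i) → Y⊥g i }) , X·Y)
... | inj₂ (Z , Z⊥g , g₀·Z) = pivot (Span⊎Separated (g ∘ suc) (c ⊙ g zero ⊕ X))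
  where
  c = X · Z
  pivot : Span (g ∘ suc) (c ⊙ g zero ⊕ X) ⊎ Separated (g ∘ suc) (c ⊙ g zero ⊕ X) → Span g X ⊎ Separated g X
  pivot (inj₁ (W , X′≡)) = inj₁ (c ∷ W , trans (sym (⊕-cancelˡ (c ⊙ g zero) X)) (cong (c ⊙ g zero ⊕_) X′≡))
  pivot (inj₂ (Y′ , Y′⊥g , X′·Y′)) = inj₂ (d ⊙ Z ⊕ Y′ , Y⊥g , X·Y)
    where
    open ≡-Reasoning
    d = Y′ · g zero
    Y⊥g : ∀ i → (d ⊙ Z ⊕ Y′) · g i ≡ false
    Y⊥g zero = begin
      (d ⊙ Z ⊕ Y′) · g zero     ≡⟨ ·-⊙⊕ˡ d Z Y′ (g zero) ⟩
      d ∧ Z · g zero xor d      ≡⟨ cong (λ b → d ∧ b xor d) (trans (·-comm Z (g zero)) g₀·Z) ⟩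
      d ∧ true xor d            ≡⟨ cong (_xor d) (∧-identityʳ d) ⟩
      d xor d                   ≡⟨ xor-same d ⟩
      false                     ∎
    Y⊥g (suc i) = begin
      (d ⊙ Z ⊕ Y′) · g (suc i)                ≡⟨ ·-⊙⊕ˡ d Z Y′ (g (suc i)) ⟩
      d ∧ Z · g (suc i) xor Y′ · g (suc i)    ≡⟨ cong₂ (λ a b → d ∧ a xor b) (Z⊥g i) (Y′⊥g i) ⟩
      d ∧ false xor false                     ≡⟨ xor-identityʳ (d ∧ false) ⟩
      d ∧ false                               ≡⟨ ∧-zeroʳ d ⟩
      false                                   ∎
    X·Y : X · (d ⊙ Z ⊕ Y′) ≡ true
    X·Y = begin
      X · (d ⊙ Z ⊕ Y′)              ≡⟨ ·-⊙⊕ʳ X d Z Y′ ⟩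
      d ∧ c xor X · Y′              ≡⟨ cong (_xor X · Y′) (∧-comm d c) ⟩
      c ∧ d xor X · Y′              ≡⟨ cong (λ b → c ∧ b xor X · Y′) (·-comm Y′ (g zero)) ⟩
      c ∧ g zero · Y′ xor X · Y′    ≡⟨ ·-⊙⊕ˡ c (g zero) X Y′ ⟨
      (c ⊙ g zero ⊕ X) · Y′         ≡⟨ X′·Y′ ⟩
      true                          ∎

perp-perp⊆Span : ∀ {k m} (g : Fin k → Subset m) X → (∀ Y → InPerp g Y → Orth X Y) → Span g X
perp-perp⊆Span g X X∈⊥⊥ with Span⊎Separated g X
... | inj₁ X∈Span               = X∈Span
... | inj₂ (Y , Y⊥g , X·Y≡true) =
  ⊥-elim (true≢false (trans (sym X·Y≡true) (Equivalence.to (Orth⇔·≡false X Y) (X∈⊥⊥ Y Y∈⊥))))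
  where
  true≢false : true ≢ false
  true≢false ()
  Y∈⊥ : InPerp g Y
  Y∈⊥ Z Z∈Span = Equivalence.from (Orth⇔·≡false Y Z) (·-Span≡false Y Y⊥g Z∈Span)

sumSel-∘-linear : ∀ {k m n} (L : Subset m → Subset n) → L ⊥ ≡ ⊥ → (∀ A B → L (A ⊕ B) ≡ L A ⊕ L B) →
                  (g : Fin k → Subset m) (W : Subset k) → sumSel (L ∘ g) W ≡ L (sumSel g W)
sumSel-∘-linear L L⊥ L⊕ g []      = sym L⊥
sumSel-∘-linear L L⊥ L⊕ g (c ∷ W) =
  trans (cong₂ _⊕_ (L⊙ c) (sumSel-∘-linear L L⊥ L⊕ (g ∘ suc) W)) (sym (L⊕ (c ⊙ g zero) (sumSel (g ∘ suc) W)))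
  where
  L⊙ : ∀ c → c ⊙ L (g zero) ≡ L (c ⊙ g zero)
  L⊙ true  = refl
  L⊙ false = sym L⊥

sumSel-⁅⁆ : ∀ {k} (W : Subset k) → sumSel ⁅_⁆ W ≡ W
sumSel-⁅⁆ []      = refl
sumSel-⁅⁆ (c ∷ W) = trans (cong (c ⊙ ⁅ zero ⁆ ⊕_) shifted) (head c)
  where
  shifted : sumSel (⁅_⁆ ∘ suc) W ≡ false ∷ W
  shifted = trans (sumSel-∘-linear (false ∷_) refl (λ _ _ → refl) ⁅_⁆ W) (cong (false ∷_) (sumSel-⁅⁆ W))
  head : ∀ c → c ⊙ ⁅ zero ⁆ ⊕ (false ∷ W) ≡ c ∷ W
  head true  = cong (true ∷_) (⊕-identityˡ W)
  head false = cong (false ∷_) (⊕-identityˡ W)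

module _ {k m} (e₁ e₂ : Fin m → Fin k) where

  δ-⊥ : δ e₁ e₂ ⊥ ≡ ⊥
  δ-⊥ = lookup-ext λ e → trans (lookup∘tabulate _ e)
    (trans (cong₂ _xor_ (lookup-⊥ (e₁ e)) (lookup-⊥ (e₂ e))) (sym (lookup-⊥ e)))

  δ-⊕ : ∀ A B → δ e₁ e₂ (A ⊕ B) ≡ δ e₁ e₂ A ⊕ δ e₁ e₂ B
  δ-⊕ A B = lookup-ext λ e → begin
    lookup (δ e₁ e₂ (A ⊕ B)) e
      ≡⟨ lookup∘tabulate _ e ⟩
    lookup (A ⊕ B) (e₁ e) xor lookup (A ⊕ B) (e₂ e)
      ≡⟨ cong₂ _xor_ (lookup-⊕ A B (e₁ e)) (lookup-⊕ A B (e₂ e)) ⟩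
    (lookup A (e₁ e) xor lookup B (e₁ e)) xor (lookup A (e₂ e) xor lookup B (e₂ e))
      ≡⟨ xor-interchange (lookup A (e₁ e)) (lookup B (e₁ e)) (lookup A (e₂ e)) (lookup B (e₂ e)) ⟩
    (lookup A (e₁ e) xor lookup A (e₂ e)) xor (lookup B (e₁ e) xor lookup B (e₂ e))
      ≡⟨ cong₂ _xor_ (lookup∘tabulate _ e) (lookup∘tabulate _ e) ⟨
    lookup (δ e₁ e₂ A) e xor lookup (δ e₁ e₂ B) e
      ≡⟨ lookup-⊕ (δ e₁ e₂ A) (δ e₁ e₂ B) e ⟨
    lookup (δ e₁ e₂ A ⊕ δ e₁ e₂ B) e ∎
    where open ≡-Reasoning

  δ≡sumSel-vcob : ∀ W → δ e₁ e₂ W ≡ sumSel (vcob e₁ e₂) W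
  δ≡sumSel-vcob W = sym (trans (sumSel-∘-linear (δ e₁ e₂) δ-⊥ δ-⊕ ⁅_⁆ W) (cong (δ e₁ e₂) (sumSel-⁅⁆ W)))

  -- A loop adds 2 to the degree and is not in the vertex coboundary, so the parities agree.
  odd-deg : ∀ v → odd (deg e₁ e₂ v) ≡ odd ∣ vcob e₁ e₂ v ∣
  odd-deg v = begin
    odd (sumℕ (List.map incidences (List.allFin m)))   ≡⟨ cong (odd ∘ sumℕ) (map-tabulate id incidences) ⟩
    odd (sumℕ (List.tabulate incidences))              ≡⟨ odd-sumℕ incidences ⟩
    sum (odd ∘ incidences)                             ≡⟨ sum-cong-≗ odd-incidences ⟩
    sum (lookup (vcob e₁ e₂ v))                        ≡⟨ odd∣∣ (vcob e₁ e₂ v) ⟨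
    odd ∣ vcob e₁ e₂ v ∣                               ∎
    where
    open ≡-Reasoning
    incidences : Fin m → ℕ
    incidences e = indicator ⌊ e₁ e ≟ v ⌋ + indicator ⌊ e₂ e ≟ v ⌋
    odd-sumℕ : ∀ {n} (f : Fin n → ℕ) → odd (sumℕ (List.tabulate f)) ≡ sum (odd ∘ f)
    odd-sumℕ {zero}  f = refl
    odd-sumℕ {suc n} f = trans (odd-+ (f zero) _) (cong (odd (f zero) xor_) (odd-sumℕ (f ∘ suc)))
    is-v : ∀ x → odd (indicator ⌊ x ≟ v ⌋) ≡ lookup ⁅ v ⁆ x
    is-v x = trans (odd-indicator _) (trans (isYes≗does (x ≟ v)) (sym (lookup-⁅⁆ v x)))
    odd-incidences : ∀ e → odd (incidences e) ≡ lookup (vcob e₁ e₂ v) e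
    odd-incidences e = begin
      odd (incidences e)
        ≡⟨ odd-+ (indicator ⌊ e₁ e ≟ v ⌋) _ ⟩
      odd (indicator ⌊ e₁ e ≟ v ⌋) xor odd (indicator ⌊ e₂ e ≟ v ⌋)
        ≡⟨ cong₂ _xor_ (is-v (e₁ e)) (is-v (e₂ e)) ⟩
      lookup ⁅ v ⁆ (e₁ e) xor lookup ⁅ v ⁆ (e₂ e)
        ≡⟨ lookup∘tabulate _ e ⟨
      lookup (vcob e₁ e₂ v) e ∎

  parity-condition⇔·≡odd : ∀ F v →
    (∣ F ∩ vcob e₁ e₂ v ∣ % 2 ≡ deg e₁ e₂ v % 2) ⇔ (F · vcob e₁ e₂ v ≡ odd ∣ vcob e₁ e₂ v ∣)
  parity-condition⇔·≡odd F v = mk⇔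
    (λ p → trans (sym (odd∣∩∣ F C)) (trans (Equivalence.to parity p) (odd-deg v)))
    (λ q → Equivalence.from parity (trans (odd∣∩∣ F C) (trans q (sym (odd-deg v)))))
    where
    C = vcob e₁ e₂ v
    parity = %2≡⇔odd≡ ∣ F ∩ C ∣ (deg e₁ e₂ v)

  ·≡false⇒∁-parity-condition : ∀ X v → X · vcob e₁ e₂ v ≡ false →
                               ∣ ∁ X ∩ vcob e₁ e₂ v ∣ % 2 ≡ deg e₁ e₂ v % 2
  ·≡false⇒∁-parity-condition X v X·C≡false =
    Equivalence.from (parity-condition⇔·≡odd (∁ X) v) (∁-·≡odd X (vcob e₁ e₂ v) X·C≡false)

  parity-condition⇒∁-·≡false : ∀ F v → ∣ F ∩ vcob e₁ e₂ v ∣ % 2 ≡ deg e₁ e₂ v % 2 →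
                               ∁ F · vcob e₁ e₂ v ≡ false
  parity-condition⇒∁-·≡false F v p =
    ∁-·≡false F (vcob e₁ e₂ v) (Equivalence.to (parity-condition⇔·≡odd F v) p)

orbitOf-step : ∀ {n k} {gens : List (Fin n → Fin n)} (O : Orbits gens k) {s} → s ∈ gens →
               ∀ f → Orbits.orbitOf O (s f) ≡ Orbits.orbitOf O f
orbitOf-step O s∈gens f = sym (Equivalence.from (Orbits.orbitEq O f _) (step s∈gens here))

module MapProperties (M : Map) where
  open Map M
  open Orbits

  Flag : Set
  Flag = Fin nflags

  edgeOf : Flag → Fin nE
  edgeOf = orbitOf edges
  vertexOf : Flag → Fin nV
  vertexOf = orbitOf vertices
  faceOf : Flag → Fin nF
  faceOf = orbitOf faces
  zigzagOf : Flag → Fin nZ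
  zigzagOf = orbitOf zigzags

  flagOf : Fin nE → Flag
  flagOf = rep edges

  edgeOf-τ₀ : ∀ f → edgeOf (τ₀ f) ≡ edgeOf f
  edgeOf-τ₀ = orbitOf-step edges (Any.here refl)
  edgeOf-τ₂ : ∀ f → edgeOf (τ₂ f) ≡ edgeOf f
  edgeOf-τ₂ = orbitOf-step edges (Any.there (Any.here refl))
  vertexOf-τ₁ : ∀ f → vertexOf (τ₁ f) ≡ vertexOf f
  vertexOf-τ₁ = orbitOf-step vertices (Any.here refl)
  vertexOf-τ₂ : ∀ f → vertexOf (τ₂ f) ≡ vertexOf f
  vertexOf-τ₂ = orbitOf-step vertices (Any.there (Any.here refl))
  faceOf-τ₀ : ∀ f → faceOf (τ₀ f) ≡ faceOf f
  faceOf-τ₀ = orbitOf-step faces (Any.here refl)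
  faceOf-τ₁ : ∀ f → faceOf (τ₁ f) ≡ faceOf f
  faceOf-τ₁ = orbitOf-step faces (Any.there (Any.here refl))
  zigzagOf-τ₁ : ∀ f → zigzagOf (τ₁ f) ≡ zigzagOf f
  zigzagOf-τ₁ = orbitOf-step zigzags (Any.here refl)
  zigzagOf-τ₀τ₂ : ∀ f → zigzagOf (τ₀ (τ₂ f)) ≡ zigzagOf f
  zigzagOf-τ₀τ₂ = orbitOf-step zigzags (Any.there (Any.here refl))

  τ₀τ₂τ₀≡τ₂ : ∀ f → τ₀ (τ₂ (τ₀ f)) ≡ τ₂ f
  τ₀τ₂τ₀≡τ₂ f = trans (cong τ₀ (sym (comm₀₂ f))) (inv₀ (τ₂ f))

  vertexOf-τ₀τ₂ : ∀ f → vertexOf (τ₀ (τ₂ f)) ≡ vertexOf (τ₀ f)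
  vertexOf-τ₀τ₂ f = trans (cong vertexOf (comm₀₂ f)) (vertexOf-τ₂ (τ₀ f))

  zigzagOf-τ₂ : ∀ f → zigzagOf (τ₂ f) ≡ zigzagOf (τ₀ f)
  zigzagOf-τ₂ f = trans (cong zigzagOf (sym (τ₀τ₂τ₀≡τ₂ f))) (zigzagOf-τ₀τ₂ (τ₀ f))

  τ₀τ₂f≢τ₀f : ∀ f → τ₀ (τ₂ f) ≢ τ₀ f
  τ₀τ₂f≢τ₀f f eq = fpf₂ f (trans (sym (inv₀ (τ₂ f))) (trans (cong τ₀ eq) (inv₀ f)))

  τ₂f≢τ₀f : ∀ f → τ₂ f ≢ τ₀ f
  τ₂f≢τ₀f f eq = fpf₀₂ f (trans (cong τ₀ eq) (inv₀ f))

  EdgeFlag : Flag → Flag → Set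
  EdgeFlag f g = g ≡ f ⊎ g ≡ τ₀ (τ₂ f) ⊎ g ≡ τ₂ f ⊎ g ≡ τ₀ f

  reach⇒EdgeFlag : ∀ {f g} → Reach (τ₀ ∷ τ₂ ∷ []) f g → EdgeFlag f g
  reach⇒EdgeFlag here = inj₁ refl
  reach⇒EdgeFlag {f} (step (Any.here refl) τ₀f↝g) with reach⇒EdgeFlag τ₀f↝g
  ... | inj₁ g≡τ₀f                 = inj₂ (inj₂ (inj₂ g≡τ₀f))
  ... | inj₂ (inj₁ g≡τ₀τ₂τ₀f)      = inj₂ (inj₂ (inj₁ (trans g≡τ₀τ₂τ₀f (τ₀τ₂τ₀≡τ₂ f))))
  ... | inj₂ (inj₂ (inj₁ g≡τ₂τ₀f)) = inj₂ (inj₁ (trans g≡τ₂τ₀f (sym (comm₀₂ f))))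
  ... | inj₂ (inj₂ (inj₂ g≡τ₀τ₀f)) = inj₁ (trans g≡τ₀τ₀f (inv₀ f))
  reach⇒EdgeFlag {f} (step (Any.there (Any.here refl)) τ₂f↝g) with reach⇒EdgeFlag τ₂f↝g
  ... | inj₁ g≡τ₂f                 = inj₂ (inj₂ (inj₁ g≡τ₂f))
  ... | inj₂ (inj₁ g≡τ₀τ₂τ₂f)      = inj₂ (inj₂ (inj₂ (trans g≡τ₀τ₂τ₂f (cong τ₀ (inv₂ f)))))
  ... | inj₂ (inj₂ (inj₁ g≡τ₂τ₂f)) = inj₁ (trans g≡τ₂τ₂f (inv₂ f))
  ... | inj₂ (inj₂ (inj₂ g≡τ₀τ₂f)) = inj₂ (inj₁ g≡τ₀τ₂f)

  fiberSum : (Flag → Bool) → Flag → Bool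
  fiberSum h f = (h f xor h (τ₀ (τ₂ f))) xor (h (τ₂ f) xor h (τ₀ f))

  onEdge : Flag → Flag → Bool
  onEdge f g = fiberSum (λ x → does (g ≟ x)) f

  EdgeFlag⇒onEdge : ∀ f g → EdgeFlag f g → onEdge f g ≡ true
  EdgeFlag⇒onEdge f g (inj₁ refl) = cong₂ _xor_
    (cong₂ _xor_ (dec-true (g ≟ _) refl) (dec-false (g ≟ _) (fpf₀₂ f ∘ sym)))
    (cong₂ _xor_ (dec-false (g ≟ _) (fpf₂ f ∘ sym)) (dec-false (g ≟ _) (fpf₀ f ∘ sym)))
  EdgeFlag⇒onEdge f g (inj₂ (inj₁ refl)) = cong₂ _xor_
    (cong₂ _xor_ (dec-false (g ≟ _) (fpf₀₂ f)) (dec-true (g ≟ _) refl))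
    (cong₂ _xor_ (dec-false (g ≟ _) (fpf₀ (τ₂ f))) (dec-false (g ≟ _) (τ₀τ₂f≢τ₀f f)))
  EdgeFlag⇒onEdge f g (inj₂ (inj₂ (inj₁ refl))) = cong₂ _xor_
    (cong₂ _xor_ (dec-false (g ≟ _) (fpf₂ f)) (dec-false (g ≟ _) (fpf₀ (τ₂ f) ∘ sym)))
    (cong₂ _xor_ (dec-true (g ≟ _) refl) (dec-false (g ≟ _) (τ₂f≢τ₀f f)))
  EdgeFlag⇒onEdge f g (inj₂ (inj₂ (inj₂ refl))) = cong₂ _xor_
    (cong₂ _xor_ (dec-false (g ≟ _) (fpf₀ f)) (dec-false (g ≟ _) (τ₀τ₂f≢τ₀f f ∘ sym)))
    (cong₂ _xor_ (dec-false (g ≟ _) (τ₂f≢τ₀f f ∘ sym)) (dec-true (g ≟ _) refl))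

  edge-fiber : ∀ e g → does (e ≟ edgeOf g) ≡ onEdge (flagOf e) g
  edge-fiber e g with e ≟ edgeOf g
  ... | yes e≡edgeOf-g = sym (EdgeFlag⇒onEdge (flagOf e) g (reach⇒EdgeFlag
          (Equivalence.to (orbitEq edges (flagOf e) g) (trans (orbitRep edges e) e≡edgeOf-g))))
  ... | no  e≢edgeOf-g = sym (cong₂ _xor_
          (cong₂ _xor_ (off refl) (off (trans (edgeOf-τ₀ _) (edgeOf-τ₂ _))))
          (cong₂ _xor_ (off (edgeOf-τ₂ _)) (off (edgeOf-τ₀ _))))
    where
    off : ∀ {x} → edgeOf x ≡ edgeOf (flagOf e) → does (g ≟ x) ≡ false
    off {x} same-edge = dec-false (g ≟ x) λ g≡x →
      e≢edgeOf-g (trans (sym (orbitRep edges e)) (trans (sym same-edge) (cong edgeOf (sym g≡x))))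

  ∑-onEdge : ∀ h f → sum (λ g → onEdge f g ∧ h g) ≡ fiberSum h f
  ∑-onEdge h f = begin
    sum (λ g → (A g xor B g) ∧ h g)            ≡⟨ sum-cong-≗ (λ g → ∧-distribʳ-xor (h g) (A g) (B g)) ⟩
    sum (λ g → (A g ∧ h g) xor (B g ∧ h g))    ≡⟨ ∑-distrib-+ (λ g → A g ∧ h g) (λ g → B g ∧ h g) ⟩
    sum (λ g → A g ∧ h g) xor sum (λ g → B g ∧ h g)
      ≡⟨ cong₂ _xor_ (∑-select₂ f (τ₀ (τ₂ f)) h) (∑-select₂ (τ₂ f) (τ₀ f) h) ⟩
    fiberSum h f ∎
    where
    open ≡-Reasoning
    A B : Flag → Bool
    A g = does (g ≟ f) xor does (g ≟ τ₀ (τ₂ f))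
    B g = does (g ≟ τ₂ f) xor does (g ≟ τ₀ f)

  ∑-edges : ∀ h → sum (λ e → fiberSum h (flagOf e)) ≡ sum h
  ∑-edges h = begin
    sum (λ e → fiberSum h (flagOf e))
      ≡⟨ sum-cong-≗ (λ e → ∑-onEdge h (flagOf e)) ⟨
    sum (λ e → sum (λ g → onEdge (flagOf e) g ∧ h g))
      ≡⟨ sum-cong-≗ (λ e → sum-cong-≗ (λ g → cong (_∧ h g) (edge-fiber e g))) ⟨
    sum (λ e → sum (λ g → does (e ≟ edgeOf g) ∧ h g))
      ≡⟨ ∑-comm (λ e g → does (e ≟ edgeOf g) ∧ h g) ⟩
    sum (λ g → sum (λ e → does (e ≟ edgeOf g) ∧ h g))
      ≡⟨ sum-cong-≗ (λ g → ∑-select (edgeOf g) (λ _ → h g)) ⟩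
    sum h ∎
    where open ≡-Reasoning

  ·≡false-by-flags : ∀ X Y (h : Flag → Bool) → (∀ g → h (τ₁ g) ≡ h g) →
                     (∀ e → lookup X e ∧ lookup Y e ≡ fiberSum h (flagOf e)) → X · Y ≡ false
  ·≡false-by-flags X Y h hτ₁≡h edgewise = begin
    X · Y                                 ≡⟨ sum-cong-≗ edgewise ⟩
    sum (λ e → fiberSum h (flagOf e))     ≡⟨ ∑-edges h ⟩
    sum h                                 ≡⟨ ∑-invariant-fpf-involution τ₁ inv₁ fpf₁ h hτ₁≡h ⟩
    false                                 ∎
    where open ≡-Reasoning

  cob₁·cob₃≡false : ∀ v z → cob₁ v · cob₃ z ≡ false
  cob₁·cob₃≡false v z = ·≡false-by-flags (cob₁ v) (cob₃ z) (λ g → α g ∧ β g)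
    (λ g → cong₂ _∧_ (cong (lookup ⁅ v ⁆) (vertexOf-τ₁ g)) (cong (lookup ⁅ z ⁆) (zigzagOf-τ₁ g))) edgewise
    where
    α β : Flag → Bool
    α g = lookup ⁅ v ⁆ (vertexOf g)
    β g = lookup ⁅ z ⁆ (zigzagOf g)
    edgewise : ∀ e → lookup (cob₁ v) e ∧ lookup (cob₃ z) e ≡ fiberSum (λ g → α g ∧ β g) (flagOf e)
    edgewise e = begin
      lookup (cob₁ v) e ∧ lookup (cob₃ z) e
        ≡⟨ cong₂ _∧_ (lookup∘tabulate _ e) (lookup∘tabulate _ e) ⟩
      (α f xor α (τ₀ f)) ∧ (β f xor β (τ₀ f))
        ≡⟨ xor-∧-expand (α f) (α (τ₀ f)) (β f) (β (τ₀ f)) ⟩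
      ((α f ∧ β f) xor (α (τ₀ f) ∧ β f)) xor ((α f ∧ β (τ₀ f)) xor (α (τ₀ f) ∧ β (τ₀ f)))
        ≡⟨ cong₂ (λ x y → ((α f ∧ β f) xor x) xor (y xor (α (τ₀ f) ∧ β (τ₀ f))))
             (cong₂ _∧_ (cong (lookup ⁅ v ⁆) (vertexOf-τ₀τ₂ f)) (cong (lookup ⁅ z ⁆) (zigzagOf-τ₀τ₂ f)))
             (cong₂ _∧_ (cong (lookup ⁅ v ⁆) (vertexOf-τ₂ f)) (cong (lookup ⁅ z ⁆) (zigzagOf-τ₂ f))) ⟨
      fiberSum (λ g → α g ∧ β g) f ∎
      where
      open ≡-Reasoning
      f = flagOf e

  cob₂·cob₃≡false : ∀ w z → cob₂ w · cob₃ z ≡ false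
  cob₂·cob₃≡false w z = ·≡false-by-flags (cob₂ w) (cob₃ z) (λ g → α g ∧ β g)
    (λ g → cong₂ _∧_ (cong (lookup ⁅ w ⁆) (faceOf-τ₁ g)) (cong (lookup ⁅ z ⁆) (zigzagOf-τ₁ g))) edgewise
    where
    α β : Flag → Bool
    α g = lookup ⁅ w ⁆ (faceOf g)
    β g = lookup ⁅ z ⁆ (zigzagOf g)
    edgewise : ∀ e → lookup (cob₂ w) e ∧ lookup (cob₃ z) e ≡ fiberSum (λ g → α g ∧ β g) (flagOf e)
    edgewise e = begin
      lookup (cob₂ w) e ∧ lookup (cob₃ z) e
        ≡⟨ cong₂ _∧_ (lookup∘tabulate _ e) (lookup∘tabulate _ e) ⟩
      (α f xor α (τ₂ f)) ∧ (β f xor β (τ₀ f))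
        ≡⟨ xor-∧-expand (α f) (α (τ₂ f)) (β f) (β (τ₀ f)) ⟩
      ((α f ∧ β f) xor (α (τ₂ f) ∧ β f)) xor ((α f ∧ β (τ₀ f)) xor (α (τ₂ f) ∧ β (τ₀ f)))
        ≡⟨ cong (((α f ∧ β f) xor (α (τ₂ f) ∧ β f)) xor_) (xor-comm (α f ∧ β (τ₀ f)) (α (τ₂ f) ∧ β (τ₀ f))) ⟩
      ((α f ∧ β f) xor (α (τ₂ f) ∧ β f)) xor ((α (τ₂ f) ∧ β (τ₀ f)) xor (α f ∧ β (τ₀ f)))
        ≡⟨ cong₂ (λ x y → ((α f ∧ β f) xor x) xor y)
             (cong₂ _∧_ (cong (lookup ⁅ w ⁆) (faceOf-τ₀ (τ₂ f))) (cong (lookup ⁅ z ⁆) (zigzagOf-τ₀τ₂ f)))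
             (cong₂ _xor_ (cong (α (τ₂ f) ∧_) (cong (lookup ⁅ z ⁆) (zigzagOf-τ₂ f)))
                          (cong (_∧ β (τ₀ f)) (cong (lookup ⁅ w ⁆) (faceOf-τ₀ f)))) ⟨
      fiberSum (λ g → α g ∧ β g) f ∎
      where
      open ≡-Reasoning
      f = flagOf e

  δ₃·cob≡false : ∀ {k} (cob : Fin k → Subset nE) → (∀ v z → cob v · cob₃ z ≡ false) →
                 ∀ W v → δ₃ W · cob v ≡ false
  δ₃·cob≡false cob cob·cob₃≡false W v =
    trans (·-comm (δ₃ W) (cob v)) (·-Span≡false (cob v) (cob·cob₃≡false v) (W , δ≡sumSel-vcob end₃ end₃' W))

  ∁δ₃-isStrongOJoin : ∀ W → StrongOJoin (∁ (δ₃ W))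
  ∁δ₃-isStrongOJoin W =
    (λ v → ·≡false⇒∁-parity-condition end₁ end₁' (δ₃ W) v (δ₃·cob≡false cob₁ cob₁·cob₃≡false W v)) ,
    (λ w → ·≡false⇒∁-parity-condition end₂ end₂' (δ₃ W) w (δ₃·cob≡false cob₂ cob₂·cob₃≡false W w))

  StrongOJoin⇒∁≡δ₃ : Rich₃ → ∀ F → StrongOJoin F → ∃ λ W → ∁ F ≡ δ₃ W
  StrongOJoin⇒∁≡δ₃ rich F (parity₁ , parity₂) with perp-perp⊆Span cob₃ (∁ F) ∁F∈𝒱₃⊥⊥
    where
    ∁F∈𝒱₃⊥⊥ : ∀ Y → InPerp cob₃ Y → Orth (∁ F) Y
    ∁F∈𝒱₃⊥⊥ Y Y∈𝒱₃⊥ = Equivalence.from (Orth⇔·≡false (∁ F) Y) (·-InSum≡false (∁ F)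
      (λ v → parity-condition⇒∁-·≡false end₁ end₁' F v (parity₁ v))
      (λ w → parity-condition⇒∁-·≡false end₂ end₂' F w (parity₂ w))
      (rich Y Y∈𝒱₃⊥))
  ... | W , ∁F≡ = W , trans ∁F≡ (sym (δ≡sumSel-vcob end₃ end₃' W))

subset-argmax : ∀ k (f : Subset k → ℕ) → ∃ λ W → ∀ W′ → f W′ ≤ f W
subset-argmax zero    f = [] , λ { [] → ≤-refl }
subset-argmax (suc k) f with subset-argmax k (f ∘ (true ∷_)) | subset-argmax k (f ∘ (false ∷_))
... | Wᵗ , maxᵗ | Wᶠ , maxᶠ with ≤-total (f (true ∷ Wᵗ)) (f (false ∷ Wᶠ))
... | inj₁ ᵗ≤ᶠ = false ∷ Wᶠ , λ { (true ∷ W′) → ≤-trans (maxᵗ W′) ᵗ≤ᶠ ; (false ∷ W′) → maxᶠ W′ }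
... | inj₂ ᶠ≤ᵗ = true ∷ Wᵗ , λ { (true ∷ W′) → maxᵗ W′ ; (false ∷ W′) → ≤-trans (maxᶠ W′) ᶠ≤ᵗ }

∣p∣≡n∸∣∁p∣ : ∀ {n} (p : Subset n) → ∣ p ∣ ≡ n ∸ ∣ ∁ p ∣
∣p∣≡n∸∣∁p∣ {n} p = sym (trans (cong (n ∸_) (∣∁p∣≡n∸∣p∣ p)) (m∸[m∸n]≡n (∣p∣≤n p)))

∣∁p∣≤∣q∣⇒∣∁q∣≤∣p∣ : ∀ {n} (p q : Subset n) → ∣ ∁ p ∣ ≤ ∣ q ∣ → ∣ ∁ q ∣ ≤ ∣ p ∣
∣∁p∣≤∣q∣⇒∣∁q∣≤∣p∣ {n} p q ∣∁p∣≤∣q∣ = begin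
  ∣ ∁ q ∣        ≡⟨ ∣∁p∣≡n∸∣p∣ q ⟩
  n ∸ ∣ q ∣      ≤⟨ ∸-monoʳ-≤ n ∣∁p∣≤∣q∣ ⟩
  n ∸ ∣ ∁ p ∣    ≡⟨ ∣p∣≡n∸∣∁p∣ p ⟨
  ∣ p ∣          ∎
  where open ≤-Reasoning

mainTheorem2 : (M : Map) → Map.Rich₃ M →
    ∃₂ λ (W : Subset (Map.nZ M)) (F : Subset (Map.nE M)) →
      (∀ W′ → ∣ Map.δ₃ M W′ ∣ ≤ ∣ Map.δ₃ M W ∣) ×
      Map.StrongOJoin M F ×
      (∀ F′ → Map.StrongOJoin M F′ → ∣ F ∣ ≤ ∣ F′ ∣) ×
      ∣ Map.δ₃ M W ∣ ≡ Map.nE M ∸ ∣ F ∣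
mainTheorem2 M rich = W , ∁ (δ₃ W) , δ₃W-maximum , ∁δ₃-isStrongOJoin W , ∁δ₃W-minimum , ∣p∣≡n∸∣∁p∣ (δ₃ W)
  where
  open Map M
  open MapProperties M
  W = proj₁ (subset-argmax nZ (∣_∣ ∘ δ₃))
  δ₃W-maximum : ∀ W′ → ∣ δ₃ W′ ∣ ≤ ∣ δ₃ W ∣
  δ₃W-maximum = proj₂ (subset-argmax nZ (∣_∣ ∘ δ₃))
  ∁δ₃W-minimum : ∀ F′ → StrongOJoin F′ → ∣ ∁ (δ₃ W) ∣ ≤ ∣ F′ ∣
  ∁δ₃W-minimum F′ F′-isStrongOJoin with StrongOJoin⇒∁≡δ₃ rich F′ F′-isStrongOJoin
  ... | W′ , ∁F′≡δ₃W′ =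
    ∣∁p∣≤∣q∣⇒∣∁q∣≤∣p∣ F′ (δ₃ W) (subst (λ X → ∣ X ∣ ≤ ∣ δ₃ W ∣) (sym ∁F′≡δ₃W′) (δ₃W-maximum W′))
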